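{- Let $k$ be a positive integer. If $H$ is a convex subgraph of a graph $G$, then $\chi_{\mu_k}(G)\ge \chi_{\mu_k}(H)$.
   Context: All graphs are finite, simple and undirected. A $u,v$-geodesic is a shortest $u,v$-path. A subgraph $H$ of $G$ is convex if for any $x,y\in V(H)$ every $x,y$-geodesic in $G$ lies entirely in $H$. For a positive integer $k$, a set $M\subseteq V(G)$ is a $k$-distance mutual-visibility set (of $G$) if for every two distinct $u,v\in M$ there is a $u,v$-geodesic in $G$ of length at most $k$ none of whose internal vertices lies in $M$. $\chi_{\mu_k}(G)$ is the minimum number of parts in a partition of $V(G)$ into $k$-distance mutual-visibility sets. -}

module Defs where

open import Data.Nat using (ℕ; zero; suc; _≤_)
open import Data.Fin using (Fin)
open import Data.Bool using (Bool; T)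
open import Data.List using (List; []; _∷_)
open import Data.List.Membership.Propositional using (_∈_)
open import Data.Product using (Σ; ∃; ∃₂; _×_; _,_)
open import Relation.Binary.PropositionalEquality using (_≡_)
open import Relation.Nullary using (¬_)
open import Function.Definitions using (Injective)

record Graph (n : ℕ) : Set where
  field
    adj    : Fin n → Fin n → Bool
    sym    : ∀ u v → adj u v ≡ adj v u
    irrefl : ∀ v → ¬ T (adj v v)

open Graph public

Adj : ∀ {n} → Graph n → Fin n → Fin n → Set
Adj G u v = T (adj G u v)

data Walk {n} (G : Graph n) : Fin n → Fin n → Set where
  [_]  : (v : Fin n) → Walk G v v
  step : (u : Fin n) {w v : Fin n} → Adj G u w → Walk G w v → Walk G u v

len : ∀ {n} {G : Graph n} {u v} → Walk G u v → ℕ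
len [ v ] = 0
len (step u e w) = suc (len w)

initVerts : ∀ {n} {G : Graph n} {u v} → Walk G u v → List (Fin n)
initVerts [ v ] = []
initVerts (step u e w) = u ∷ initVerts w

internal : ∀ {n} {G : Graph n} {u v} → Walk G u v → List (Fin n)
internal [ v ] = []
internal (step u e w) = initVerts w

IsGeodesic : ∀ {n} (G : Graph n) {u v} → Walk G u v → Set
IsGeodesic G {u} {v} w = ∀ (w' : Walk G u v) → len w ≤ len w'

IsKDMV : ∀ {n} (G : Graph n) (k : ℕ) → (Fin n → Set) → Set
IsKDMV G k M =
  ∀ u v → M u → M v → ¬ (u ≡ v) →
    Σ (Walk G u v) λ w →
      IsGeodesic G w × len w ≤ k × (∀ x → x ∈ internal w → ¬ M x)

-- a partition of V(G) into (at most) p parts, each a k-distance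
-- mutual-visibility set, given as a part-assignment c : V(G) → Fin p
-- (part i is the set {v | c v ≡ i}).
HasKDMVPartition : ∀ {n} (G : Graph n) (k p : ℕ) → Set
HasKDMVPartition {n} G k p =
  Σ (Fin n → Fin p) λ c → ∀ (i : Fin p) → IsKDMV G k (λ v → c v ≡ i)

IsChiMuK : ∀ {n} (G : Graph n) (k p : ℕ) → Set
IsChiMuK G k p = HasKDMVPartition G k p × (∀ q → HasKDMVPartition G k q → p ≤ q)

IsSubgraphVia : ∀ {m n} (H : Graph m) (G : Graph n) → (Fin m → Fin n) → Set
IsSubgraphVia H G f = Injective _≡_ _≡_ f × (∀ a b → Adj H a b → Adj G (f a) (f b))

LiesIn : ∀ {m n} (H : Graph m) {G : Graph n} (f : Fin m → Fin n) {u v} → Walk G u v → Set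
LiesIn H f [ v ] = ∃ λ a → f a ≡ v
LiesIn H f (step u {w} e p) =
  (∃₂ λ a b → f a ≡ u × f b ≡ w × Adj H a b) × LiesIn H f p

IsConvexSubgraphVia : ∀ {m n} (H : Graph m) (G : Graph n) → (Fin m → Fin n) → Set
IsConvexSubgraphVia H G f =
  IsSubgraphVia H G f ×
  (∀ a b (w : Walk G (f a) (f b)) → IsGeodesic G w → LiesIn H f w)

{-# OPTIONS --safe #-}
module Submission where

open import Defs hiding (sym)
open import Data.Nat using (ℕ; suc; _≤_; NonZero)
open import Data.Nat.Properties using (≤-trans; ≤-reflexive; module ≤-Reasoning)
open import Data.Fin using (Fin)
open import Data.List using (_∷_; map; drop)
open import Data.List.Properties using (drop-map)
open import Data.List.Membership.Propositional using (_∈_)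
open import Data.List.Membership.Propositional.Properties using (∈-map⁺)
open import Data.Product using (_,_)
open import Function using (_∘_)
open import Function.Definitions using (Injective)
open import Relation.Binary.PropositionalEquality
  using (_≡_; refl; sym; trans; cong; cong₂; subst; module ≡-Reasoning)

-- A geodesic of G between vertices of a convex subgraph H lies in H, so it
-- lifts to a walk of H of the same length with the same internal vertices.
-- The lift is a geodesic of H, since every walk of H is also a walk of G.
-- Hence each part of a k-distance mutual-visibility partition of G
-- restricts to such a set of H, and χ_{μ_k}(H) ≤ χ_{μ_k}(G).

internal≡drop1-initVerts : ∀ {n} {G : Graph n} {u v} (w : Walk G u v) →
                           internal w ≡ drop 1 (initVerts w)
internal≡drop1-initVerts [ v ]        = refl
internal≡drop1-initVerts (step u e w) = refl

module _ {m n} {H : Graph m} {G : Graph n} {f : Fin m → Fin n} where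

  module _ (hom : ∀ a b → Adj H a b → Adj G (f a) (f b)) where

    map-walk : ∀ {a b} → Walk H a b → Walk G (f a) (f b)
    map-walk [ a ]            = [ f a ]
    map-walk (step a {b} e w) = step (f a) (hom a b e) (map-walk w)

    len-map-walk : ∀ {a b} (w : Walk H a b) → len (map-walk w) ≡ len w
    len-map-walk [ a ]        = refl
    len-map-walk (step a e w) = cong suc (len-map-walk w)

  -- The vertex invariant is kept on initVerts, which, unlike internal, is
  -- compositional along step.
  record Lift {u v} (w : Walk G u v) (a b : Fin m) : Set where
    field
      walk           : Walk H a b
      len-walk       : len walk ≡ len w
      initVerts-walk : map f (initVerts walk) ≡ initVerts w

    internal-walk : map f (internal walk) ≡ internal w
    internal-walk = begin
      map f (internal walk)           ≡⟨ cong (map f) (internal≡drop1-initVerts walk) ⟩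
      map f (drop 1 (initVerts walk)) ≡⟨ drop-map 1 (initVerts walk) ⟨
      drop 1 (map f (initVerts walk)) ≡⟨ cong (drop 1) initVerts-walk ⟩
      drop 1 (initVerts w)            ≡⟨ internal≡drop1-initVerts w ⟨
      internal w                      ∎
      where open ≡-Reasoning

  open Lift

  lift : Injective _≡_ _≡_ f → ∀ {u v} (w : Walk G u v) → LiesIn H f w →
         ∀ {a b} → f a ≡ u → f b ≡ v → Lift w a b
  lift inj [ v ] _ fa≡v fb≡v with inj (trans fa≡v (sym fb≡v))
  ... | refl = record { walk = [ _ ] ; len-walk = refl ; initVerts-walk = refl }
  lift inj (step u e w) ((a′ , b′ , fa′≡u , fb′≡w , e′) , w-in-H) fa≡u fb≡v
    with inj (trans fa′≡u (sym fa≡u))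
  ... | refl = record
    { walk           = step a′ e′ (walk tail)
    ; len-walk       = cong suc (len-walk tail)
    ; initVerts-walk = cong₂ _∷_ fa′≡u (initVerts-walk tail)
    }
    where tail = lift inj w w-in-H fb′≡w fb≡v

  lift-isGeodesic : (hom : ∀ a b → Adj H a b → Adj G (f a) (f b)) →
                    ∀ {a b} {w : Walk G (f a) (f b)} (L : Lift w a b) →
                    IsGeodesic G w → IsGeodesic H (walk L)
  lift-isGeodesic hom {w = w} L w-geo w′ = begin
    len (walk L)          ≡⟨ len-walk L ⟩
    len w                 ≤⟨ w-geo (map-walk hom w′) ⟩
    len (map-walk hom w′) ≡⟨ len-map-walk hom w′ ⟩
    len w′                ∎
    where open ≤-Reasoning

  IsKDMV-restrict : IsConvexSubgraphVia H G f → ∀ {k} {M : Fin n → Set} →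
                    IsKDMV G k M → IsKDMV H k (M ∘ f)
  IsKDMV-restrict ((inj , hom) , convex) M-visible a b Ma Mb a≢b
    with M-visible (f a) (f b) Ma Mb (a≢b ∘ inj)
  ... | w , w-geo , w≤k , w-clear =
    walk L ,
    lift-isGeodesic hom L w-geo ,
    ≤-trans (≤-reflexive (len-walk L)) w≤k ,
    λ x x∈ → w-clear (f x) (subst (f x ∈_) (internal-walk L) (∈-map⁺ f x∈))
    where L = lift inj w (convex a b w w-geo) refl refl

  HasKDMVPartition-restrict : IsConvexSubgraphVia H G f → ∀ {k p} →
                              HasKDMVPartition G k p → HasKDMVPartition H k p
  HasKDMVPartition-restrict convex (c , parts) =
    c ∘ f , λ i → IsKDMV-restrict convex (parts i)

proposition2p5 : (k : ℕ) → NonZero k →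
    ∀ {m n} (G : Graph n) (H : Graph m) (f : Fin m → Fin n) →
    IsConvexSubgraphVia H G f →
    ∀ p q → IsChiMuK G k p → IsChiMuK H k q → q ≤ p
proposition2p5 k _ G H f convex p q (partitionG , _) (_ , minimalH) =
  minimalH p (HasKDMVPartition-restrict convex partitionG)
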